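{- Let $F$ and $G$ be first-order sentences such that $F \models G$. Then the CTI procedure (described in the context) applied to $F$ and $G$ outputs a Craig-Lyndon interpolant of $F$ and $G$.
   Context: First-order logic without equality. For a formula $F$, $\mathrm{pred}(F)$ is the set of pairs (predicate, polarity) of predicate occurrences in $F$ (polarity positive if in the scope of an even number of negations, negative otherwise), and $\mathrm{fun}(F)$ is the set of function symbols (including constants) occurring in $F$. A Craig-Lyndon interpolant of sentences $F,G$ with $F\models G$ is a sentence $H$ with $F \models H \models G$, $\mathrm{pred}(H)\subseteq \mathrm{pred}(F)\cap\mathrm{pred}(G)$ and $\mathrm{fun}(H)\subseteq\mathrm{fun}(F)\cap\mathrm{fun}(G)$. Clausal tableaux: a literal is an atom or negated atom, $\overline{L}$ its complement; a clause is a disjunction of literals, a clausal formula a conjunction of clauses. A clausal tableau for a clausal formula $F$ is a finite ordered tree whose non-root nodes $N$ carry literal labels $\mathrm{lit}(N)$ such that for each node with children the disjunction $\mathrm{clause}(N)$ of its children's labels (left to right) is an instance of a clause of $F$. A node $N$ is closed if some ancestor $N'$ has $\mathrm{lit}(N')=\overline{\mathrm{lit}(N)}$, one such ancestor being fixed as target $\mathrm{tgt}(N)$; the tableau is closed if all leaves are closed, ground if all labels are ground. A two-sided clausal tableau for clausal formulas $F_{\mathrm{red}},F_{\mathrm{blue}}$ is a clausal tableau for $F_{\mathrm{red}}\wedge F_{\mathrm{blue}}$ whose non-root nodes have side labels in $\{\mathrm{red},\mathrm{blue}\}$, siblings sharing the side, such that if the children of $N$ have side $S$ then $\mathrm{clause}(N)$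 is an instance of a clause of $F_S$. For a closed two-sided ground tableau, $\mathrm{ipol}(N)$ is defined inductively: for a leaf $N$ it is $\bot$, $\mathrm{lit}(N)$, $\overline{\mathrm{lit}(N)}$, $\top$ according as $(\mathrm{side}(N),\mathrm{side}(\mathrm{tgt}(N)))$ is (red,red), (red,blue), (blue,red), (blue,blue); for an inner node with children $N_1,\dots,N_n$ it is $\bigvee_i\mathrm{ipol}(N_i)$ if the children are red and $\bigwedge_i\mathrm{ipol}(N_i)$ if they are blue. CTI procedure. Input: first-order sentences $F,G$ with $F\models G$. Convert $F$ and $\neg G$ by normal form transformation and Skolemization into sentences $\exists \mathbf{f}_c \forall \mathbf{u}_c F_c$ and $\exists\mathbf{g}_c\forall\mathbf{v}_c \neg G_c$ equivalent to $F$ and $\neg G$ respectively (second-order quantification over the Skolem functions), where $\mathbf{f}_c,\mathbf{g}_c$ are disjoint sets of fresh Skolem functions and $F_c$, $\neg G_c$ denote clausal formulas with variables $\mathbf{u}_c$, $\mathbf{v}_c$ (write $NG_c$ for the second clausal formula). Let $k$ be a fresh constant. Construct a closed two-sided clausal ground tableau for $F_c$ and $NG_c$ all of whose labels are built from $k$ and functions occurring in $F_c$ or $NG_c$, and let $H_b=\mathrm{ipol}(N)$ for its root $N$. Let $\mathbf{f}=\mathrm{fun}(F_c)\setminus\mathrm{fun}(NG_c)$ and $\mathbf{g}=(\mathrm{fun}(NG_c)\setminus\mathrm{fun}(F_c))\cup\{k\}$; a term whose outermost function symbol lies in a set $S$ is called an $S$-term. Consider the terms that are $\mathbf{g}$-terms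 or $\mathbf{f}$-terms and occur in $H_b$ at some position other than as a strict subterm of another $\mathbf{f}$-term or $\mathbf{g}$-term. Assign to each such term a distinct fresh variable (universal variables for the $\mathbf{g}$-terms, existential variables for the $\mathbf{f}$-terms), and let $H_q$ be $H_b$ with all occurrences of these terms that are not strict subterms of another such term replaced by their assigned variables. Let $z_1,\dots,z_n$ be the assigned variables occurring in $H_q$, ordered so that if the term of $z_i$ is a strict subterm of the term of $z_j$ then $i<j$; let $Q_i=\forall$ if $z_i$ was assigned to a $\mathbf{g}$-term and $Q_i=\exists$ otherwise. Output: $Q_1z_1\dots Q_nz_n\,H_q$. -}

module Defs where

open import Level using (0ℓ)
open import Data.Nat using (ℕ; zero; suc; _≟_)
open import Data.Bool using (Bool; true; false; not)
open import Data.List using (List; []; _∷_; _++_; map; length; lookup)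
open import Data.List.Membership.Propositional using (_∈_; _∉_)
open import Data.List.Relation.Unary.Any using (Any)
open import Data.List.Relation.Unary.All using (All)
open import Data.List.Relation.Unary.Unique.Propositional using (Unique)
open import Data.Product using (Σ; _×_; _,_; proj₁; proj₂)
open import Data.Sum using (_⊎_)
open import Data.Empty using (⊥)
open import Data.Unit using (⊤)
open import Data.Maybe using (Maybe; just; nothing)
open import Data.Fin using (Fin) renaming (_<_ to _<ᶠ_)
open import Relation.Nullary using (¬_; yes; no)
open import Relation.Binary.PropositionalEquality using (_≡_)

-- Syntax of first-order logic without equality
-- Function/predicate symbols are named by ℕ; a symbol is identified by
-- the pair (name , arity), arity = number of arguments at an occurrence.

Sym : Set
Sym = ℕ × ℕ

data Term : Set where
  var : ℕ → Term
  app : ℕ → List Term → Term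

data Formula : Set where
  atom : ℕ → List Term → Formula
  tt ff : Formula
  neg : Formula → Formula
  _∧ᶠ_ _∨ᶠ_ : Formula → Formula → Formula
  all ex : ℕ → Formula → Formula

mutual
  funT : Term → List Sym
  funT (var _) = []
  funT (app f ts) = (f , length ts) ∷ funTs ts

  funTs : List Term → List Sym
  funTs [] = []
  funTs (t ∷ ts) = funT t ++ funTs ts

funF : Formula → List Sym
funF (atom p ts) = funTs ts
funF tt = []
funF ff = []
funF (neg φ) = funF φ
funF (φ ∧ᶠ ψ) = funF φ ++ funF ψ
funF (φ ∨ᶠ ψ) = funF φ ++ funF ψ
funF (all x φ) = funF φ
funF (ex x φ) = funF φ

-- pred(·): (predicate symbol , polarity), true = positive
PredOcc : Set
PredOcc = Sym × Bool

predP : Bool → Formula → List PredOcc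
predP b (atom p ts) = ((p , length ts) , b) ∷ []
predP b tt = []
predP b ff = []
predP b (neg φ) = predP (not b) φ
predP b (φ ∧ᶠ ψ) = predP b φ ++ predP b ψ
predP b (φ ∨ᶠ ψ) = predP b φ ++ predP b ψ
predP b (all x φ) = predP b φ
predP b (ex x φ) = predP b φ

pred : Formula → List PredOcc
pred = predP true

mutual
  varsT : Term → List ℕ
  varsT (var x) = x ∷ []
  varsT (app f ts) = varsTs ts

  varsTs : List Term → List ℕ
  varsTs [] = []
  varsTs (t ∷ ts) = varsT t ++ varsTs ts

FreeIn : ℕ → Formula → Set
FreeIn x (atom p ts) = x ∈ varsTs ts
FreeIn x tt = ⊥
FreeIn x ff = ⊥
FreeIn x (neg φ) = FreeIn x φ
FreeIn x (φ ∧ᶠ ψ) = FreeIn x φ ⊎ FreeIn x ψ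
FreeIn x (φ ∨ᶠ ψ) = FreeIn x φ ⊎ FreeIn x ψ
FreeIn x (all y φ) = ¬ (x ≡ y) × FreeIn x φ
FreeIn x (ex y φ) = ¬ (x ≡ y) × FreeIn x φ

Sentence : Formula → Set
Sentence φ = ∀ x → ¬ FreeIn x φ

-- Tarski semantics (structures interpret every symbol; a function
-- symbol f of arity n is interpreted by fn f on argument lists of length n)

record Structure : Set₁ where
  field
    D  : Set
    fn : ℕ → List D → D
    pr : ℕ → List D → Set

module _ (M : Structure) where
  open Structure M

  mutual
    evalT : (ℕ → D) → Term → D
    evalT ρ (var x) = ρ x
    evalT ρ (app f ts) = fn f (evalTs ρ ts)

    evalTs : (ℕ → D) → List Term → List D
    evalTs ρ [] = []
    evalTs ρ (t ∷ ts) = evalT ρ t ∷ evalTs ρ ts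

  update : (ℕ → D) → ℕ → D → ℕ → D
  update ρ x d y with x ≟ y
  ... | yes _ = d
  ... | no _ = ρ y

  sat : (ℕ → D) → Formula → Set
  sat ρ (atom p ts) = pr p (evalTs ρ ts)
  sat ρ tt = ⊤
  sat ρ ff = ⊥
  sat ρ (neg φ) = ¬ sat ρ φ
  sat ρ (φ ∧ᶠ ψ) = sat ρ φ × sat ρ ψ
  sat ρ (φ ∨ᶠ ψ) = sat ρ φ ⊎ sat ρ ψ
  sat ρ (all x φ) = ∀ d → sat (update ρ x d) φ
  sat ρ (ex x φ) = Σ D λ d → sat (update ρ x d) φ

_⊨_ : Formula → Formula → Set₁
F ⊨ G = ∀ M ρ → sat M ρ F → sat M ρ G

Interpolant : Formula → Formula → Formula → Set₁
Interpolant F G H =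
  Sentence H × (F ⊨ H) × (H ⊨ G)
  × (∀ x → x ∈ pred H → x ∈ pred F × x ∈ pred G)
  × (∀ h → h ∈ funF H → h ∈ funF F × h ∈ funF G)

record Literal : Set where
  constructor lit
  field
    pos   : Bool
    pname : ℕ
    args  : List Term
open Literal public

Clause : Set
Clause = List Literal

Clausal : Set
Clausal = List Clause

compl : Literal → Literal
compl (lit b p ts) = lit (not b) p ts

litF : Literal → Formula
litF (lit true p ts) = atom p ts
litF (lit false p ts) = neg (atom p ts)

mutual
  substT : (ℕ → Term) → Term → Term
  substT σ (var x) = σ x
  substT σ (app f ts) = app f (substTs σ ts)

  substTs : (ℕ → Term) → List Term → List Term
  substTs σ [] = []
  substTs σ (t ∷ ts) = substT σ t ∷ substTs σ ts

substL : (ℕ → Term) → Literal → Literal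
substL σ (lit b p ts) = lit b p (substTs σ ts)

predCl : Clause → List PredOcc
predCl [] = []
predCl (lit b p ts ∷ C) = ((p , length ts) , b) ∷ predCl C

predC : Clausal → List PredOcc
predC [] = []
predC (C ∷ Cs) = predCl C ++ predC Cs

funCl : Clause → List Sym
funCl [] = []
funCl (lit b p ts ∷ C) = funTs ts ++ funCl C

funC : Clausal → List Sym
funC [] = []
funC (C ∷ Cs) = funCl C ++ funC Cs

satL : (M : Structure) → (ℕ → Structure.D M) → Literal → Set
satL M ρ l = sat M ρ (litF l)

satC : Structure → Clausal → Set
satC M Fc = ∀ ρ → All (λ C → Any (satL M ρ) C) Fc

-- M has an expansion (reinterpreting exactly the symbols in S) satisfying ∀u Fc,
-- i.e. M ⊨ ∃S ∀u Fc  (second-order quantification over the Skolem functions S)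
SkolemSat : Structure → List Sym → Clausal → Set
SkolemSat M S Fc =
  Σ (ℕ → List (Structure.D M) → Structure.D M) λ fn′ →
    (∀ f as → (f , length as) ∉ S → fn′ f as ≡ Structure.fn M f as)
    × satC (record M { fn = fn′ }) Fc

SkolemEquiv : Formula → List Sym → Clausal → Set₁
SkolemEquiv φ S Fc =
  ∀ M → ((∀ ρ → sat M ρ φ) → SkolemSat M S Fc) × (SkolemSat M S Fc → ∀ ρ → sat M ρ φ)

data Side : Set where
  red blue : Side

-- A non-root node: either a leaf (with its target, given as the number of
-- steps upwards among its proper non-root ancestors: 0 = parent), or an
-- inner node together with the common side of its children.
data Tree : Set where
  leaf : Literal → ℕ → Tree
  node : Literal → Side → List Tree → Tree

label : Tree → Literal
label (leaf L _) = L
label (node L _ _) = L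

record Tableau : Set where
  constructor tableau
  field
    rootSide     : Side
    rootChildren : List Tree

-- context of proper non-root ancestors (nearest first), with their sides
Ctx : Set
Ctx = List (Literal × Side)

nth : {A : Set} → List A → ℕ → Maybe A
nth [] _ = nothing
nth (x ∷ xs) zero = just x
nth (x ∷ xs) (suc n) = nth xs n

module Tableaux (Fc NGc : Clausal) (k : ℕ) where

  clausesOf : Side → Clausal
  clausesOf red = Fc
  clausesOf blue = NGc

  IsInstance : Clausal → List Literal → Set
  IsInstance Fs D = Σ Clause λ C → C ∈ Fs × Σ (ℕ → Term) λ σ → map (substL σ) C ≡ D

  allowedSyms : List Sym
  allowedSyms = funC Fc ++ funC NGc ++ ((k , 0) ∷ [])

  mutual
    AllowedT : Term → Set
    AllowedT (var _) = ⊥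
    AllowedT (app f ts) = (f , length ts) ∈ allowedSyms × AllowedTs ts

    AllowedTs : List Term → Set
    AllowedTs [] = ⊤
    AllowedTs (t ∷ ts) = AllowedT t × AllowedTs ts

  AllowedL : Literal → Set
  AllowedL (lit b p ts) = AllowedTs ts

  mutual
    ValidT : Ctx → Side → Tree → Set
    ValidT ctx s (leaf L i) =
      AllowedL L × Σ (Literal × Side) λ e → nth ctx i ≡ just e × proj₁ e ≡ compl L
    ValidT ctx s (node L s′ cs) =
      AllowedL L × ¬ (cs ≡ []) × IsInstance (clausesOf s′) (map label cs)
      × ValidTs ((L , s) ∷ ctx) s′ cs

    ValidTs : Ctx → Side → List Tree → Set
    ValidTs ctx s [] = ⊤
    ValidTs ctx s (t ∷ ts) = ValidT ctx s t × ValidTs ctx s ts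

  ClosedGroundTableau : Tableau → Set
  ClosedGroundTableau (tableau s cs) =
    ¬ (cs ≡ []) × IsInstance (clausesOf s) (map label cs) × ValidTs [] s cs

bigOr : List Formula → Formula
bigOr [] = ff
bigOr (φ ∷ []) = φ
bigOr (φ ∷ ψ ∷ φs) = φ ∨ᶠ bigOr (ψ ∷ φs)

bigAnd : List Formula → Formula
bigAnd [] = tt
bigAnd (φ ∷ []) = φ
bigAnd (φ ∷ ψ ∷ φs) = φ ∧ᶠ bigAnd (ψ ∷ φs)

combine : Side → List Formula → Formula
combine red = bigOr
combine blue = bigAnd

leafIpol : Side → Maybe Side → Literal → Formula
leafIpol red (just red) L = ff
leafIpol red (just blue) L = litF L
leafIpol blue (just red) L = litF (compl L)
leafIpol blue (just blue) L = tt
leafIpol _ nothing L = ff   -- does not occur for closed tableaux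

targetSide : Ctx → ℕ → Maybe Side
targetSide ctx i with nth ctx i
... | just e = just (proj₂ e)
... | nothing = nothing

mutual
  ipolT : Ctx → Side → Tree → Formula
  ipolT ctx s (leaf L i) = leafIpol s (targetSide ctx i) L
  ipolT ctx s (node L s′ cs) = combine s′ (ipolTs ((L , s) ∷ ctx) s′ cs)

  ipolTs : Ctx → Side → List Tree → List Formula
  ipolTs ctx s [] = []
  ipolTs ctx s (t ∷ ts) = ipolT ctx s t ∷ ipolTs ctx s ts

ipolRoot : Tableau → Formula
ipolRoot (tableau s cs) = combine s (ipolTs [] s cs)

data Quant : Set where
  ∀q ∃q : Quant

record Binding : Set where
  constructor bind
  field
    bterm  : Term
    bvar   : ℕ
    bquant : Quant
open Binding public

quantify : List Binding → Formula → Formula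
quantify [] φ = φ
quantify (bind t z ∀q ∷ bs) φ = all z (quantify bs φ)
quantify (bind t z ∃q ∷ bs) φ = ex z (quantify bs φ)

mutual
  SubT : Term → Term → Set
  SubT s t = s ≡ t ⊎ StrictSub s t

  StrictSub : Term → Term → Set
  StrictSub s (var _) = ⊥
  StrictSub s (app f ts) = SubTs s ts

  SubTs : Term → List Term → Set
  SubTs s [] = ⊥
  SubTs s (t ∷ ts) = SubT s t ⊎ SubTs s ts

module Lifting (Fc NGc : Clausal) (k : ℕ) where

  IsFsym : Sym → Set
  IsFsym h = h ∈ funC Fc × h ∉ funC NGc

  IsGsym : Sym → Set
  IsGsym h = (h ∈ funC NGc × h ∉ funC Fc) ⊎ h ≡ (k , 0)

  IsFterm : Term → Set
  IsFterm (var _) = ⊥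
  IsFterm (app f ts) = IsFsym (f , length ts)

  IsGterm : Term → Set
  IsGterm (var _) = ⊥
  IsGterm (app f ts) = IsGsym (f , length ts)

  Colored : Term → Set
  Colored t = IsFterm t ⊎ IsGterm t

  mutual
    TopOccT : Term → Term → Set
    TopOccT t (var x) = t ≡ var x
    TopOccT t (app f us) = t ≡ app f us ⊎ (¬ Colored (app f us) × TopOccTs t us)

    TopOccTs : Term → List Term → Set
    TopOccTs t [] = ⊥
    TopOccTs t (u ∷ us) = TopOccT t u ⊎ TopOccTs t us

  TopOccF : Term → Formula → Set
  TopOccF t (atom p ts) = TopOccTs t ts
  TopOccF t tt = ⊥
  TopOccF t ff = ⊥
  TopOccF t (neg φ) = TopOccF t φ
  TopOccF t (φ ∧ᶠ ψ) = TopOccF t φ ⊎ TopOccF t ψ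
  TopOccF t (φ ∨ᶠ ψ) = TopOccF t φ ⊎ TopOccF t ψ
  TopOccF t (all x φ) = TopOccF t φ
  TopOccF t (ex x φ) = TopOccF t φ

  -- the terms that receive a variable
  Assigned : Formula → Term → Set
  Assigned Hb t = Colored t × TopOccF t Hb

  module Replace (qs : List Binding) where
    mutual
      ReplT : Term → Term → Set
      ReplT (var x) u = u ≡ var x
      ReplT (app f ts) u =
        (Colored (app f ts) × Σ Binding λ b → b ∈ qs × bterm b ≡ app f ts × u ≡ var (bvar b))
        ⊎ (¬ Colored (app f ts) × Σ (List Term) λ us → u ≡ app f us × ReplTs ts us)

      ReplTs : List Term → List Term → Set
      ReplTs [] [] = ⊤
      ReplTs [] (_ ∷ _) = ⊥
      ReplTs (_ ∷ _) [] = ⊥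
      ReplTs (t ∷ ts) (u ∷ us) = ReplT t u × ReplTs ts us

    ReplF : Formula → Formula → Set
    ReplF (atom p ts) ψ = Σ (List Term) λ us → ψ ≡ atom p us × ReplTs ts us
    ReplF tt ψ = ψ ≡ tt
    ReplF ff ψ = ψ ≡ ff
    ReplF (neg φ) ψ = Σ Formula λ φ′ → ψ ≡ neg φ′ × ReplF φ φ′
    ReplF (φ₁ ∧ᶠ φ₂) ψ = Σ Formula λ ψ₁ → Σ Formula λ ψ₂ →
      ψ ≡ (ψ₁ ∧ᶠ ψ₂) × ReplF φ₁ ψ₁ × ReplF φ₂ ψ₂
    ReplF (φ₁ ∨ᶠ φ₂) ψ = Σ Formula λ ψ₁ → Σ Formula λ ψ₂ →
      ψ ≡ (ψ₁ ∨ᶠ ψ₂) × ReplF φ₁ ψ₁ × ReplF φ₂ ψ₂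
    ReplF (all x φ) ψ = Σ Formula λ φ′ → ψ ≡ all x φ′ × ReplF φ φ′
    ReplF (ex x φ) ψ = Σ Formula λ φ′ → ψ ≡ ex x φ′ × ReplF φ φ′

-- A run of the CTI procedure on F, G with output H (all nondeterministic
-- choices -- clausification, k, tableau, variable names, quantifier order --
-- are fields)

record CTIRun (F G H : Formula) : Set₁ where
  field
    fs gs : List Sym
    Fc NGc : Clausal
    fs-fresh : ∀ h → h ∈ fs → h ∉ funF F × h ∉ funF G
    gs-fresh : ∀ h → h ∈ gs → h ∉ funF F × h ∉ funF G
    fs-gs-disjoint : ∀ h → h ∈ fs → h ∉ gs
    Fc-fun : ∀ h → h ∈ funC Fc → h ∈ funF F ⊎ h ∈ fs
    NGc-fun : ∀ h → h ∈ funC NGc → h ∈ funF (neg G) ⊎ h ∈ gs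
    Fc-pred : ∀ x → x ∈ predC Fc → x ∈ pred F
    NGc-pred : ∀ x → x ∈ predC NGc → x ∈ pred (neg G)
    Fc-equiv : SkolemEquiv F fs Fc
    NGc-equiv : SkolemEquiv (neg G) gs NGc
    k : ℕ
    k-fresh : (k , 0) ∉ (funF F ++ funF G ++ fs ++ gs ++ funC Fc ++ funC NGc)
    T : Tableau
    T-closed : Tableaux.ClosedGroundTableau Fc NGc k T
    -- lifting: bindings (term , variable , quantifier), in prefix order z₁ … zₙ
    qs : List Binding
    qs-terms-unique : Unique (map bterm qs)
    qs-vars-unique : Unique (map bvar qs)
    qs-assigned : ∀ t → (t ∈ map bterm qs → Lifting.Assigned Fc NGc k (ipolRoot T) t)
                      × (Lifting.Assigned Fc NGc k (ipolRoot T) t → t ∈ map bterm qs)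
    qs-quant : ∀ b → b ∈ qs → (bquant b ≡ ∀q → Lifting.IsGterm Fc NGc k (bterm b))
                              × (bquant b ≡ ∃q → Lifting.IsFterm Fc NGc k (bterm b))
    qs-order : ∀ (i j : Fin (length qs)) →
      StrictSub (bterm (lookup qs i)) (bterm (lookup qs j)) → i <ᶠ j
    Hq : Formula
    Hq-repl : Lifting.Replace.ReplF Fc NGc k qs (ipolRoot T) Hq
    output : H ≡ quantify qs Hq

-- Write Hb for the ground interpolant of the closed tableau.  Induction over
-- the tableau shows that every model of Fc satisfies Hb and every model of NGc
-- falsifies it: along a branch, the literals of the model's own side hold, and a
-- closed leaf either contradicts one of them or contributes the shared literal
-- to Hb.  Lifting preserves this.  In a model of Fc the g-terms, whose symbols
-- do not occur in Fc, may be reinterpreted at will; so when the opponent picks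
-- the value of a universally bound g-term we reinterpret that term accordingly
-- (in a copy of the model whose elements remember the ground term they denote),
-- and an existentially bound f-term is witnessed by its own value.  Binding
-- subterms first makes these choices independent.  Dually for NGc.  The Skolem
-- functions are then eliminated, since the lifted formula only contains symbols
-- that occur in both Fc and NGc, hence in both F and G.
module Submission where

open import Defs
open import Level using (0ℓ)
open import Axiom.ExcludedMiddle using (ExcludedMiddle)
open import Data.Bool using (true; false; not)
open import Data.Empty using (⊥; ⊥-elim)
open import Data.Fin using (Fin) renaming (zero to fzero; suc to fsuc; _<_ to _<ᶠ_)
open import Data.List using (List; []; _∷_; _++_; _∷ʳ_; map; length; lookup)
open import Data.List.Properties using (length-map; ∷ʳ-++; ++-identityʳ)
open import Data.List.Membership.Propositional using (_∈_; _∉_; find; lose)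
open import Data.List.Membership.Propositional.Properties using (∈-++⁺ˡ; ∈-++⁺ʳ; ∈-++⁻; ∈-map⁺)
open import Data.List.Relation.Binary.Pointwise using (Pointwise; []; _∷_; Pointwise-≡⇒≡)
open import Data.List.Relation.Unary.All as All using (All; []; _∷_)
import Data.List.Relation.Unary.All.Properties as All
open import Data.List.Relation.Unary.AllPairs as AllPairs using (AllPairs; []; _∷_)
open import Data.List.Relation.Unary.Any as Any using (Any; here; there)
import Data.List.Relation.Unary.Any.Properties as Any
open import Data.List.Relation.Unary.Unique.Propositional using (Unique)
open import Data.Maybe using (just; nothing)
open import Data.Nat using (ℕ; zero; suc; _≟_)
open import Data.Nat.Properties using (≤-pred)
open import Data.Product using (∃; _×_; _,_; proj₁; proj₂)
open import Data.Product.Function.NonDependent.Propositional using (_×-⇔_)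
open import Data.Product.Properties using (≡-dec)
open import Data.Sum using (_⊎_; inj₁; inj₂; [_,_]′)
open import Data.Sum.Function.Propositional using (_⊎-⇔_)
open import Data.Unit using (⊤; tt)
open import Function using (_∘_)
open import Function.Bundles using (_⇔_; mk⇔; Equivalence)
open import Function.Construct.Identity using (⇔-id)
open import Function.Construct.Symmetry using (⇔-sym)
open import Function.Related.TypeIsomorphisms using (¬-cong-⇔)
open import Relation.Nullary using (¬_; Dec; yes; no)
open import Relation.Binary.PropositionalEquality
  using (_≡_; _≢_; refl; sym; trans; cong; cong₂; subst; module ≡-Reasoning)

open import Data.List.Membership.DecPropositional (≡-dec _≟_ _≟_) using (_∈?_)
open Equivalence using (to; from)

length-evalTs : ∀ M ρ ts → length (evalTs M ρ ts) ≡ length ts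
length-evalTs M ρ [] = refl
length-evalTs M ρ (t ∷ ts) = cong suc (length-evalTs M ρ ts)

module Transfer
  (M₁ M₂ : Structure) (R : Structure.D M₁ → Structure.D M₂ → Set)
  (R-total : ∀ d → ∃ (R d)) (R-onto : ∀ e → ∃ λ d → R d e)
  (R-pr : ∀ p {as bs} → Pointwise R as bs → Structure.pr M₁ p as ⇔ Structure.pr M₂ p bs)
  where
  open Structure M₁ using () renaming (D to D₁; fn to fn₁)
  open Structure M₂ using () renaming (D to D₂; fn to fn₂)

  RespectsFns : List Sym → Set
  RespectsFns S = ∀ f {as bs} → (f , length as) ∈ S → Pointwise R as bs → R (fn₁ f as) (fn₂ f bs)

  RelatedOn : (ℕ → Set) → (ℕ → D₁) → (ℕ → D₂) → Set
  RelatedOn V ρ₁ ρ₂ = ∀ x → V x → R (ρ₁ x) (ρ₂ x)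

  mutual
    evalT-related : ∀ t {ρ₁ ρ₂} → RelatedOn (_∈ varsT t) ρ₁ ρ₂ → RespectsFns (funT t) →
                    R (evalT M₁ ρ₁ t) (evalT M₂ ρ₂ t)
    evalT-related (var x) ρR fR = ρR x (here refl)
    evalT-related (app f ts) {ρ₁} ρR fR =
      fR f (here (cong (f ,_) (length-evalTs M₁ ρ₁ ts))) (evalTs-related ts ρR (λ g m → fR g (there m)))

    evalTs-related : ∀ ts {ρ₁ ρ₂} → RelatedOn (_∈ varsTs ts) ρ₁ ρ₂ → RespectsFns (funTs ts) →
                     Pointwise R (evalTs M₁ ρ₁ ts) (evalTs M₂ ρ₂ ts)
    evalTs-related [] ρR fR = []
    evalTs-related (t ∷ ts) ρR fR =
      evalT-related t (λ x m → ρR x (∈-++⁺ˡ m)) (λ g m → fR g (∈-++⁺ˡ m))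
      ∷ evalTs-related ts (λ x m → ρR x (∈-++⁺ʳ (varsT t) m)) (λ g m → fR g (∈-++⁺ʳ (funT t) m))

  update-related : ∀ {V ρ₁ ρ₂} y {d e} → R d e → RelatedOn (λ x → x ≢ y × V x) ρ₁ ρ₂ →
                   RelatedOn V (update M₁ ρ₁ y d) (update M₂ ρ₂ y e)
  update-related y r ρR x v with y ≟ x
  ... | yes _ = r
  ... | no y≢x = ρR x ((λ x≡y → y≢x (sym x≡y)) , v)

  sat-transfer : ∀ φ {ρ₁ ρ₂} → RelatedOn (λ x → FreeIn x φ) ρ₁ ρ₂ → RespectsFns (funF φ) →
                 sat M₁ ρ₁ φ ⇔ sat M₂ ρ₂ φ
  sat-transfer (atom p ts) ρR fR = R-pr p (evalTs-related ts ρR fR)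
  sat-transfer tt ρR fR = ⇔-id _
  sat-transfer ff ρR fR = ⇔-id _
  sat-transfer (neg φ) ρR fR = ¬-cong-⇔ (sat-transfer φ ρR fR)
  sat-transfer (φ ∧ᶠ ψ) ρR fR =
    sat-transfer φ (λ x m → ρR x (inj₁ m)) (λ f m → fR f (∈-++⁺ˡ m))
    ×-⇔ sat-transfer ψ (λ x m → ρR x (inj₂ m)) (λ f m → fR f (∈-++⁺ʳ (funF φ) m))
  sat-transfer (φ ∨ᶠ ψ) ρR fR =
    sat-transfer φ (λ x m → ρR x (inj₁ m)) (λ f m → fR f (∈-++⁺ˡ m))
    ⊎-⇔ sat-transfer ψ (λ x m → ρR x (inj₂ m)) (λ f m → fR f (∈-++⁺ʳ (funF φ) m))
  sat-transfer (all y φ) ρR fR = mk⇔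
    (λ s e → let (d , r) = R-onto e in to (sat-transfer φ (update-related y r ρR) fR) (s d))
    (λ s d → let (e , r) = R-total d in from (sat-transfer φ (update-related y r ρR) fR) (s e))
  sat-transfer (ex y φ) ρR fR = mk⇔
    (λ (d , s) → let (e , r) = R-total d in e , to (sat-transfer φ (update-related y r ρR) fR) s)
    (λ (e , s) → let (d , r) = R-onto e in d , from (sat-transfer φ (update-related y r ρR) fR) s)

withFns : (M : Structure) → (ℕ → List (Structure.D M) → Structure.D M) → Structure
withFns M fn′ = record M { fn = fn′ }

module _ (M : Structure) (fn′ : ℕ → List (Structure.D M) → Structure.D M) where
  open Structure M

  private
    pr-cong : ∀ p {as bs} → Pointwise _≡_ as bs → pr p as ⇔ pr p bs
    pr-cong p as≈bs with Pointwise-≡⇒≡ as≈bs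
    ... | refl = ⇔-id _

    module Same = Transfer (withFns M fn′) M _≡_ (λ d → d , refl) (λ d → d , refl) pr-cong

  sat-withFns : ∀ ρ ρ′ φ → (∀ x → FreeIn x φ → ρ x ≡ ρ′ x) →
                (∀ f as → (f , length as) ∈ funF φ → fn′ f as ≡ fn f as) →
                sat (withFns M fn′) ρ φ ⇔ sat M ρ′ φ
  sat-withFns ρ ρ′ φ agree-vars agree-fns = Same.sat-transfer φ agree-vars
    (λ f {as} m as≈bs → trans (agree-fns f as m) (cong (fn f) (Pointwise-≡⇒≡ as≈bs)))

sentence-env-irrelevant : ∀ M φ → Sentence φ → ∀ ρ ρ′ → sat M ρ φ → sat M ρ′ φ
sentence-env-irrelevant M φ closed ρ ρ′ =
  to (sat-withFns M (Structure.fn M) ρ ρ′ φ (λ x free → ⊥-elim (closed x free)) (λ _ _ _ → refl))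

module _ (M : Structure) where
  open Structure M

  mutual
    evalT-substT : ∀ ρ σ t → evalT M ρ (substT σ t) ≡ evalT M (evalT M ρ ∘ σ) t
    evalT-substT ρ σ (var x) = refl
    evalT-substT ρ σ (app f ts) = cong (fn f) (evalTs-substTs ρ σ ts)

    evalTs-substTs : ∀ ρ σ ts → evalTs M ρ (substTs σ ts) ≡ evalTs M (evalT M ρ ∘ σ) ts
    evalTs-substTs ρ σ [] = refl
    evalTs-substTs ρ σ (t ∷ ts) = cong₂ _∷_ (evalT-substT ρ σ t) (evalTs-substTs ρ σ ts)

  satL-substL : ∀ ρ σ {L} → satL M (evalT M ρ ∘ σ) L → satL M ρ (substL σ L)
  satL-substL ρ σ {lit true p ts} rewrite evalTs-substTs ρ σ ts = λ s → s
  satL-substL ρ σ {lit false p ts} rewrite evalTs-substTs ρ σ ts = λ s → s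

  compl-excludes : ∀ ρ L → satL M ρ (compl L) → ¬ satL M ρ L
  compl-excludes ρ (lit true p ts) c l = c l
  compl-excludes ρ (lit false p ts) c l = l c

  module _ (ρ : ℕ → D) where
    bigOr-sat : ∀ φs → Any (sat M ρ) φs → sat M ρ (bigOr φs)
    bigOr-sat (φ ∷ []) (here s) = s
    bigOr-sat (φ ∷ ψ ∷ φs) (here s) = inj₁ s
    bigOr-sat (φ ∷ ψ ∷ φs) (there s) = inj₂ (bigOr-sat (ψ ∷ φs) s)

    bigOr-unsat : ∀ φs → All (¬_ ∘ sat M ρ) φs → ¬ sat M ρ (bigOr φs)
    bigOr-unsat (φ ∷ []) (n ∷ _) s = n s
    bigOr-unsat (φ ∷ ψ ∷ φs) (n ∷ _) (inj₁ s) = n s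
    bigOr-unsat (φ ∷ ψ ∷ φs) (_ ∷ ns) (inj₂ s) = bigOr-unsat (ψ ∷ φs) ns s

    bigAnd-sat : ∀ φs → All (sat M ρ) φs → sat M ρ (bigAnd φs)
    bigAnd-sat [] _ = tt
    bigAnd-sat (φ ∷ []) (s ∷ _) = s
    bigAnd-sat (φ ∷ ψ ∷ φs) (s ∷ ss) = s , bigAnd-sat (ψ ∷ φs) ss

    bigAnd-unsat : ∀ φs → Any (¬_ ∘ sat M ρ) φs → ¬ sat M ρ (bigAnd φs)
    bigAnd-unsat (φ ∷ []) (here n) s = n s
    bigAnd-unsat (φ ∷ ψ ∷ φs) (here n) (s , _) = n s
    bigAnd-unsat (φ ∷ ψ ∷ φs) (there n) (_ , s) = bigAnd-unsat (ψ ∷ φs) n s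

nth-All : ∀ {A : Set} {P : A → Set} {xs x} i → All P xs → nth xs i ≡ just x → P x
nth-All zero (p ∷ _) refl = p
nth-All (suc i) (_ ∷ ps) eq = nth-All i ps eq

targetSide-nth : ∀ ctx i {e} → nth ctx i ≡ just e → targetSide ctx i ≡ just (proj₂ e)
targetSide-nth ctx i eq with nth ctx i
targetSide-nth ctx i refl | just _ = refl

Signed : Side → Set → Set
Signed red P = P
Signed blue P = ¬ P

module Soundness (Fc NGc : Clausal) (k : ℕ) where
  open Tableaux Fc NGc k

  instance-satisfied : ∀ M {Fs D} → satC M Fs → IsInstance Fs D → ∀ ρ → Any (satL M ρ) D
  instance-satisfied M sat-Fs (C , C∈Fs , σ , refl) ρ =
    Any.map⁺ (Any.map (λ {L} → satL-substL M ρ σ {L}) (All.lookup (sat-Fs (evalT M ρ ∘ σ)) C∈Fs))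

  module _ (M : Structure) (ρ : ℕ → Structure.D M) where

    BranchTrue : Side → Ctx → Set
    BranchTrue S = All (λ (L , s) → s ≡ S → satL M ρ L)

    leafIpol-sound : ∀ S s t L → (s ≡ S → satL M ρ L) → (t ≡ S → satL M ρ (compl L)) →
                     Signed S (sat M ρ (leafIpol s (just t) L))
    leafIpol-sound red red red L l c = compl-excludes M ρ L (c refl) (l refl)
    leafIpol-sound red red blue L l c = l refl
    leafIpol-sound red blue red L l c = c refl
    leafIpol-sound red blue blue L l c = tt
    leafIpol-sound blue red red L l c = λ ()
    leafIpol-sound blue red blue L l c = compl-excludes M ρ L (c refl)
    leafIpol-sound blue blue red L l c = λ s → compl-excludes M ρ L s (l refl)
    leafIpol-sound blue blue blue L l c = λ _ → compl-excludes M ρ L (c refl) (l refl)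

    mutual
      tree-sound : ∀ S → satC M (clausesOf S) → ∀ ctx s t → ValidT ctx s t →
                   BranchTrue S ((label t , s) ∷ ctx) → Signed S (sat M ρ (ipolT ctx s t))
      tree-sound S _ ctx s (leaf L i) (_ , (L′ , t) , nth≡ , L′≡) (l ∷ br)
        rewrite targetSide-nth ctx i nth≡ =
        leafIpol-sound S s t L l (subst (λ L″ → t ≡ S → satL M ρ L″) L′≡ (nth-All i br nth≡))
      tree-sound S sat-S ctx s (node L s′ cs) (_ , _ , inst , valid) br =
        children-sound S sat-S ((L , s) ∷ ctx) s′ cs inst valid br

      children-sound : ∀ S → satC M (clausesOf S) → ∀ ctx s cs → IsInstance (clausesOf s) (map label cs) →
                       ValidTs ctx s cs → BranchTrue S ctx → Signed S (sat M ρ (combine s (ipolTs ctx s cs)))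
      children-sound red sat-S ctx red cs inst valid br =
        bigOr-sat M ρ _ (some-child-sound red sat-S ctx cs valid br (instance-satisfied M sat-S inst ρ))
      children-sound red sat-S ctx blue cs inst valid br =
        bigAnd-sat M ρ _ (every-child-sound red sat-S ctx blue cs (λ ()) valid br)
      children-sound blue sat-S ctx red cs inst valid br =
        bigOr-unsat M ρ _ (every-child-sound blue sat-S ctx red cs (λ ()) valid br)
      children-sound blue sat-S ctx blue cs inst valid br =
        bigAnd-unsat M ρ _ (some-child-sound blue sat-S ctx cs valid br (instance-satisfied M sat-S inst ρ))

      some-child-sound : ∀ S → satC M (clausesOf S) → ∀ ctx cs → ValidTs ctx S cs → BranchTrue S ctx →
                         Any (satL M ρ) (map label cs) → Any (Signed S ∘ sat M ρ) (ipolTs ctx S cs)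
      some-child-sound S sat-S ctx (c ∷ cs) (v , _) br (here l) =
        here (tree-sound S sat-S ctx S c v ((λ _ → l) ∷ br))
      some-child-sound S sat-S ctx (c ∷ cs) (_ , vs) br (there l) =
        there (some-child-sound S sat-S ctx cs vs br l)

      every-child-sound : ∀ S → satC M (clausesOf S) → ∀ ctx s cs → s ≢ S → ValidTs ctx s cs → BranchTrue S ctx →
                          All (Signed S ∘ sat M ρ) (ipolTs ctx s cs)
      every-child-sound S sat-S ctx s [] s≢S _ br = []
      every-child-sound S sat-S ctx s (c ∷ cs) s≢S (v , vs) br =
        tree-sound S sat-S ctx s c v ((λ s≡S → ⊥-elim (s≢S s≡S)) ∷ br)
        ∷ every-child-sound S sat-S ctx s cs s≢S vs br

  ipolRoot-sound : ∀ M ρ S T → ClosedGroundTableau T → satC M (clausesOf S) → Signed S (sat M ρ (ipolRoot T))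
  ipolRoot-sound M ρ S (tableau s cs) (_ , inst , valid) sat-S = children-sound M ρ S sat-S [] s cs inst valid []

mutual
  Ground : Term → Set
  Ground (var _) = ⊥
  Ground (app f ts) = Grounds ts

  Grounds : List Term → Set
  Grounds [] = ⊤
  Grounds (t ∷ ts) = Ground t × Grounds ts

mutual
  substT-ground : ∀ σ t → Ground t → substT σ t ≡ t
  substT-ground σ (app f ts) g = cong (app f) (substTs-ground σ ts g)

  substTs-ground : ∀ σ ts → Grounds ts → substTs σ ts ≡ ts
  substTs-ground σ [] _ = refl
  substTs-ground σ (t ∷ ts) (g , gs) = cong₂ _∷_ (substT-ground σ t g) (substTs-ground σ ts gs)

mutual
  _≟ᵗ_ : (t u : Term) → Dec (t ≡ u)
  var x ≟ᵗ var y with x ≟ y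
  ... | yes refl = yes refl
  ... | no x≢y = no λ { refl → x≢y refl }
  var _ ≟ᵗ app _ _ = no λ ()
  app _ _ ≟ᵗ var _ = no λ ()
  app f ts ≟ᵗ app g us with f ≟ g | ts ≟ᵗˢ us
  ... | yes refl | yes refl = yes refl
  ... | no f≢g | _ = no λ { refl → f≢g refl }
  ... | yes _ | no ts≢us = no λ { refl → ts≢us refl }

  _≟ᵗˢ_ : (ts us : List Term) → Dec (ts ≡ us)
  [] ≟ᵗˢ [] = yes refl
  [] ≟ᵗˢ (_ ∷ _) = no λ ()
  (_ ∷ _) ≟ᵗˢ [] = no λ ()
  (t ∷ ts) ≟ᵗˢ (u ∷ us) with t ≟ᵗ u | ts ≟ᵗˢ us
  ... | yes refl | yes refl = yes refl
  ... | no t≢u | _ = no λ { refl → t≢u refl }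
  ... | yes _ | no ts≢us = no λ { refl → ts≢us refl }

record ClosedUnderConnectives (P : Formula → Set) : Set where
  field
    P-tt : P tt
    P-ff : P ff
    P-∧ : ∀ {φ ψ} → P φ → P ψ → P (φ ∧ᶠ ψ)
    P-∨ : ∀ {φ ψ} → P φ → P ψ → P (φ ∨ᶠ ψ)

  combine-preserves : ∀ s φs → All P φs → P (combine s φs)
  combine-preserves red [] _ = P-ff
  combine-preserves red (φ ∷ []) (p ∷ _) = p
  combine-preserves red (φ ∷ ψ ∷ φs) (p ∷ ps) = P-∨ p (combine-preserves red (ψ ∷ φs) ps)
  combine-preserves blue [] _ = P-tt
  combine-preserves blue (φ ∷ []) (p ∷ _) = p
  combine-preserves blue (φ ∷ ψ ∷ φs) (p ∷ ps) = P-∧ p (combine-preserves blue (ψ ∷ φs) ps)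

module IpolInduction (Fc NGc : Clausal) (k : ℕ) (P : Formula → Set) (closed : ClosedUnderConnectives P)
  (Inv : Literal × Side → Set)
  (Inv-clause : ∀ s D → Tableaux.IsInstance Fc NGc k (Tableaux.clausesOf Fc NGc k s) D → All (λ L → Inv (L , s)) D)
  (P-leaf : ∀ ctx s L i → Tableaux.ValidT Fc NGc k ctx s (leaf L i) → All Inv ((L , s) ∷ ctx) → P (ipolT ctx s (leaf L i)))
  where
  open Tableaux Fc NGc k
  open ClosedUnderConnectives closed

  mutual
    ipolT-preserves : ∀ ctx s t → ValidT ctx s t → All Inv ((label t , s) ∷ ctx) → P (ipolT ctx s t)
    ipolT-preserves ctx s (leaf L i) valid inv = P-leaf ctx s L i valid inv
    ipolT-preserves ctx s (node L s′ cs) (_ , _ , inst , valid) inv =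
      children-preserve ((L , s) ∷ ctx) s′ cs inst valid inv

    children-preserve : ∀ ctx s cs → IsInstance (clausesOf s) (map label cs) → ValidTs ctx s cs →
                        All Inv ctx → P (combine s (ipolTs ctx s cs))
    children-preserve ctx s cs inst valid inv =
      combine-preserves s _ (ipolTs-preserve ctx s cs valid (All.map⁻ (Inv-clause s _ inst)) inv)

    ipolTs-preserve : ∀ ctx s cs → ValidTs ctx s cs → All (λ c → Inv (label c , s)) cs → All Inv ctx →
           All P (ipolTs ctx s cs)
    ipolTs-preserve ctx s [] _ _ _ = []
    ipolTs-preserve ctx s (c ∷ cs) (v , vs) (i ∷ is) inv =
      ipolT-preserves ctx s c v (i ∷ inv) ∷ ipolTs-preserve ctx s cs vs is inv

  ipolRoot-preserves : ∀ T → ClosedGroundTableau T → P (ipolRoot T)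
  ipolRoot-preserves (tableau s cs) (_ , inst , valid) = children-preserve [] s cs inst valid []

Denotes : (M : Structure) → (ℕ → Structure.D M) → Binding → Set
Denotes M ρ b = ρ (bvar b) ≡ evalT M ρ (bterm b)

module HbSyntax (Fc NGc : Clausal) (k : ℕ) where
  open Tableaux Fc NGc k
  open Lifting Fc NGc k

  AllowedQF : Formula → Set
  AllowedQF (atom p ts) = AllowedTs ts
  AllowedQF tt = ⊤
  AllowedQF ff = ⊤
  AllowedQF (neg φ) = AllowedQF φ
  AllowedQF (φ ∧ᶠ ψ) = AllowedQF φ × AllowedQF ψ
  AllowedQF (φ ∨ᶠ ψ) = AllowedQF φ × AllowedQF ψ
  AllowedQF (all x φ) = ⊥
  AllowedQF (ex x φ) = ⊥

  allowedQF-leafIpol : ∀ s ms L → AllowedL L → AllowedQF (leafIpol s ms L)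
  allowedQF-leafIpol red (just red) L a = tt
  allowedQF-leafIpol red (just blue) (lit true p ts) a = a
  allowedQF-leafIpol red (just blue) (lit false p ts) a = a
  allowedQF-leafIpol blue (just red) (lit true p ts) a = a
  allowedQF-leafIpol blue (just red) (lit false p ts) a = a
  allowedQF-leafIpol blue (just blue) L a = tt
  allowedQF-leafIpol red nothing L a = tt
  allowedQF-leafIpol blue nothing L a = tt

  ipolRoot-allowedQF : ∀ T → ClosedGroundTableau T → AllowedQF (ipolRoot T)
  ipolRoot-allowedQF = IpolInduction.ipolRoot-preserves Fc NGc k AllowedQF
    (record { P-tt = tt ; P-ff = tt ; P-∧ = _,_ ; P-∨ = _,_ })
    (λ _ → ⊤) (λ _ _ _ → All.tabulate (λ _ → tt))
    (λ ctx s L i (allowed , _) _ → allowedQF-leafIpol s (targetSide ctx i) L allowed)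

  mutual
    allowedT-ground : ∀ t → AllowedT t → Ground t
    allowedT-ground (app f ts) (_ , as) = allowedTs-ground ts as

    allowedTs-ground : ∀ ts → AllowedTs ts → Grounds ts
    allowedTs-ground [] _ = tt
    allowedTs-ground (t ∷ ts) (a , as) = allowedT-ground t a , allowedTs-ground ts as

  mutual
    topOccT-ground : ∀ t u → AllowedT u → TopOccT t u → Ground t
    topOccT-ground t (app f us) a (inj₁ refl) = allowedT-ground (app f us) a
    topOccT-ground t (app f us) (_ , as) (inj₂ (_ , occ)) = topOccTs-ground t us as occ

    topOccTs-ground : ∀ t us → AllowedTs us → TopOccTs t us → Ground t
    topOccTs-ground t (u ∷ us) (a , _) (inj₁ occ) = topOccT-ground t u a occ
    topOccTs-ground t (u ∷ us) (_ , as) (inj₂ occ) = topOccTs-ground t us as occ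

  topOccF-ground : ∀ t φ → AllowedQF φ → TopOccF t φ → Ground t
  topOccF-ground t (atom p ts) a occ = topOccTs-ground t ts a occ
  topOccF-ground t (neg φ) a occ = topOccF-ground t φ a occ
  topOccF-ground t (φ ∧ᶠ ψ) (a , _) (inj₁ occ) = topOccF-ground t φ a occ
  topOccF-ground t (φ ∧ᶠ ψ) (_ , a) (inj₂ occ) = topOccF-ground t ψ a occ
  topOccF-ground t (φ ∨ᶠ ψ) (a , _) (inj₁ occ) = topOccF-ground t φ a occ
  topOccF-ground t (φ ∨ᶠ ψ) (_ , a) (inj₂ occ) = topOccF-ground t ψ a occ

  ColoredSym : Sym → Set
  ColoredSym h = IsFsym h ⊎ IsGsym h

  module ReplaceLemmas (qs : List Binding) where
    open Replace qs

    module _ (M : Structure) (ρ : ℕ → Structure.D M) (denotes : All (Denotes M ρ) qs) where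
      mutual
        ReplT-eval : ∀ t u → ReplT t u → evalT M ρ u ≡ evalT M ρ t
        ReplT-eval (var x) u refl = refl
        ReplT-eval (app f ts) u (inj₁ (_ , b , b∈qs , refl , refl)) = All.lookup denotes b∈qs
        ReplT-eval (app f ts) u (inj₂ (_ , us , refl , r)) = cong (Structure.fn M f) (ReplTs-eval ts us r)

        ReplTs-eval : ∀ ts us → ReplTs ts us → evalTs M ρ us ≡ evalTs M ρ ts
        ReplTs-eval [] [] _ = refl
        ReplTs-eval (t ∷ ts) (u ∷ us) (r , rs) = cong₂ _∷_ (ReplT-eval t u r) (ReplTs-eval ts us rs)

      ReplF-sat : ∀ φ ψ → AllowedQF φ → ReplF φ ψ → sat M ρ ψ ⇔ sat M ρ φ
      ReplF-sat (atom p ts) ψ a (us , refl , r) rewrite ReplTs-eval ts us r = ⇔-id _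
      ReplF-sat tt ψ a refl = ⇔-id _
      ReplF-sat ff ψ a refl = ⇔-id _
      ReplF-sat (neg φ) ψ a (φ′ , refl , r) = ¬-cong-⇔ (ReplF-sat φ φ′ a r)
      ReplF-sat (φ₁ ∧ᶠ φ₂) ψ (a₁ , a₂) (ψ₁ , ψ₂ , refl , r₁ , r₂) =
        ReplF-sat φ₁ ψ₁ a₁ r₁ ×-⇔ ReplF-sat φ₂ ψ₂ a₂ r₂
      ReplF-sat (φ₁ ∨ᶠ φ₂) ψ (a₁ , a₂) (ψ₁ , ψ₂ , refl , r₁ , r₂) =
        ReplF-sat φ₁ ψ₁ a₁ r₁ ⊎-⇔ ReplF-sat φ₂ ψ₂ a₂ r₂

    ReplTs-length : ∀ ts us → ReplTs ts us → length us ≡ length ts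
    ReplTs-length [] [] _ = refl
    ReplTs-length (t ∷ ts) (u ∷ us) (_ , rs) = cong suc (ReplTs-length ts us rs)

    UncoloredAllowed : Sym → Set
    UncoloredAllowed h = h ∈ allowedSyms × ¬ ColoredSym h

    mutual
      ReplT-funT : ∀ t u → AllowedT t → ReplT t u → ∀ h → h ∈ funT u → UncoloredAllowed h
      ReplT-funT (app f ts) u _ (inj₁ (_ , _ , _ , _ , refl)) h ()
      ReplT-funT (app f ts) u (a , _) (inj₂ (uncolored , us , refl , r)) h (here refl)
        rewrite ReplTs-length ts us r = a , uncolored
      ReplT-funT (app f ts) u (_ , as) (inj₂ (_ , us , refl , r)) h (there m) = ReplTs-funTs ts us as r h m

      ReplTs-funTs : ∀ ts us → AllowedTs ts → ReplTs ts us → ∀ h → h ∈ funTs us → UncoloredAllowed h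
      ReplTs-funTs (t ∷ ts) (u ∷ us) (a , as) (r , rs) h m with ∈-++⁻ (funT u) m
      ... | inj₁ m′ = ReplT-funT t u a r h m′
      ... | inj₂ m′ = ReplTs-funTs ts us as rs h m′

    ReplF-funF : ∀ φ ψ → AllowedQF φ → ReplF φ ψ → ∀ h → h ∈ funF ψ → UncoloredAllowed h
    ReplF-funF (atom p ts) ψ a (us , refl , r) h m = ReplTs-funTs ts us a r h m
    ReplF-funF tt ψ a refl h ()
    ReplF-funF ff ψ a refl h ()
    ReplF-funF (neg φ) ψ a (φ′ , refl , r) h m = ReplF-funF φ φ′ a r h m
    ReplF-funF (φ₁ ∧ᶠ φ₂) ψ (a₁ , a₂) (ψ₁ , ψ₂ , refl , r₁ , r₂) h m with ∈-++⁻ (funF ψ₁) m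
    ... | inj₁ m′ = ReplF-funF φ₁ ψ₁ a₁ r₁ h m′
    ... | inj₂ m′ = ReplF-funF φ₂ ψ₂ a₂ r₂ h m′
    ReplF-funF (φ₁ ∨ᶠ φ₂) ψ (a₁ , a₂) (ψ₁ , ψ₂ , refl , r₁ , r₂) h m with ∈-++⁻ (funF ψ₁) m
    ... | inj₁ m′ = ReplF-funF φ₁ ψ₁ a₁ r₁ h m′
    ... | inj₂ m′ = ReplF-funF φ₂ ψ₂ a₂ r₂ h m′

    mutual
      ReplT-varsT : ∀ t u → AllowedT t → ReplT t u → ∀ x → x ∈ varsT u → x ∈ map bvar qs
      ReplT-varsT (app f ts) u _ (inj₁ (_ , b , b∈qs , _ , refl)) x (here refl) = ∈-map⁺ bvar b∈qs
      ReplT-varsT (app f ts) u (_ , as) (inj₂ (_ , us , refl , r)) x m = ReplTs-varsTs ts us as r x m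

      ReplTs-varsTs : ∀ ts us → AllowedTs ts → ReplTs ts us → ∀ x → x ∈ varsTs us → x ∈ map bvar qs
      ReplTs-varsTs (t ∷ ts) (u ∷ us) (a , as) (r , rs) x m with ∈-++⁻ (varsT u) m
      ... | inj₁ m′ = ReplT-varsT t u a r x m′
      ... | inj₂ m′ = ReplTs-varsTs ts us as rs x m′

    ReplF-free : ∀ φ ψ → AllowedQF φ → ReplF φ ψ → ∀ x → FreeIn x ψ → x ∈ map bvar qs
    ReplF-free (atom p ts) ψ a (us , refl , r) x m = ReplTs-varsTs ts us a r x m
    ReplF-free tt ψ a refl x ()
    ReplF-free ff ψ a refl x ()
    ReplF-free (neg φ) ψ a (φ′ , refl , r) x m = ReplF-free φ φ′ a r x m
    ReplF-free (φ₁ ∧ᶠ φ₂) ψ (a₁ , _) (ψ₁ , ψ₂ , refl , r₁ , r₂) x (inj₁ m) = ReplF-free φ₁ ψ₁ a₁ r₁ x m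
    ReplF-free (φ₁ ∧ᶠ φ₂) ψ (_ , a₂) (ψ₁ , ψ₂ , refl , r₁ , r₂) x (inj₂ m) = ReplF-free φ₂ ψ₂ a₂ r₂ x m
    ReplF-free (φ₁ ∨ᶠ φ₂) ψ (a₁ , _) (ψ₁ , ψ₂ , refl , r₁ , r₂) x (inj₁ m) = ReplF-free φ₁ ψ₁ a₁ r₁ x m
    ReplF-free (φ₁ ∨ᶠ φ₂) ψ (_ , a₂) (ψ₁ , ψ₂ , refl , r₁ , r₂) x (inj₂ m) = ReplF-free φ₂ ψ₂ a₂ r₂ x m

    predP-ReplF : ∀ b φ ψ → ReplF φ ψ → predP b ψ ≡ predP b φ
    predP-ReplF b (atom p ts) ψ (us , refl , r) rewrite ReplTs-length ts us r = refl
    predP-ReplF b tt ψ refl = refl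
    predP-ReplF b ff ψ refl = refl
    predP-ReplF b (neg φ) ψ (φ′ , refl , r) = predP-ReplF (not b) φ φ′ r
    predP-ReplF b (φ₁ ∧ᶠ φ₂) ψ (ψ₁ , ψ₂ , refl , r₁ , r₂) =
      cong₂ _++_ (predP-ReplF b φ₁ ψ₁ r₁) (predP-ReplF b φ₂ ψ₂ r₂)
    predP-ReplF b (φ₁ ∨ᶠ φ₂) ψ (ψ₁ , ψ₂ , refl , r₁ , r₂) =
      cong₂ _++_ (predP-ReplF b φ₁ ψ₁ r₁) (predP-ReplF b φ₂ ψ₂ r₂)
    predP-ReplF b (all x φ) ψ (φ′ , refl , r) = predP-ReplF b φ φ′ r
    predP-ReplF b (ex x φ) ψ (φ′ , refl , r) = predP-ReplF b φ φ′ r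

litOcc : Literal → PredOcc
litOcc (lit b p ts) = (p , length ts) , b

compl-involutive : ∀ L → compl (compl L) ≡ L
compl-involutive (lit true p ts) = refl
compl-involutive (lit false p ts) = refl

pred-litF : ∀ L x → x ∈ pred (litF L) → x ≡ litOcc L
pred-litF (lit true p ts) x (here refl) = refl
pred-litF (lit false p ts) x (here refl) = refl

predP-not : ∀ c φ {x b} → (x , b) ∈ predP c φ → (x , not b) ∈ predP (not c) φ
predP-not c (atom p ts) (here refl) = here refl
predP-not c (neg φ) m = predP-not (not c) φ m
predP-not c (φ ∧ᶠ ψ) m with ∈-++⁻ (predP c φ) m
... | inj₁ m′ = ∈-++⁺ˡ (predP-not c φ m′)
... | inj₂ m′ = ∈-++⁺ʳ (predP (not c) φ) (predP-not c ψ m′)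
predP-not c (φ ∨ᶠ ψ) m with ∈-++⁻ (predP c φ) m
... | inj₁ m′ = ∈-++⁺ˡ (predP-not c φ m′)
... | inj₂ m′ = ∈-++⁺ʳ (predP (not c) φ) (predP-not c ψ m′)
predP-not c (all y φ) m = predP-not c φ m
predP-not c (ex y φ) m = predP-not c φ m

litOcc-substL : ∀ σ L → litOcc (substL σ L) ≡ litOcc L
litOcc-substL σ (lit b p ts) = cong (λ n → (p , n) , b) (length-substTs ts)
  where
  length-substTs : ∀ ts → length (substTs σ ts) ≡ length ts
  length-substTs [] = refl
  length-substTs (t ∷ ts) = cong suc (length-substTs ts)

litOcc-∈-predCl : ∀ {L C} → L ∈ C → litOcc L ∈ predCl C
litOcc-∈-predCl {C = lit b p ts ∷ C} (here refl) = here refl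
litOcc-∈-predCl {C = lit b p ts ∷ C} (there m) = there (litOcc-∈-predCl m)

predCl-⊆-predC : ∀ {x C Fs} → C ∈ Fs → x ∈ predCl C → x ∈ predC Fs
predCl-⊆-predC {Fs = C ∷ Fs} (here refl) m = ∈-++⁺ˡ m
predCl-⊆-predC {Fs = C′ ∷ Fs} (there C∈) m = ∈-++⁺ʳ (predCl C′) (predCl-⊆-predC C∈ m)

module PredBookkeeping (Fc NGc : Clausal) (k : ℕ) (F G : Formula)
  (Fc-pred : ∀ x → x ∈ predC Fc → x ∈ pred F) (NGc-pred : ∀ x → x ∈ predC NGc → x ∈ pred (neg G))
  where
  open Tableaux Fc NGc k

  instance-litOcc : ∀ Fs D → IsInstance Fs D → All (λ L → litOcc L ∈ predC Fs) D
  instance-litOcc Fs D (C , C∈Fs , σ , refl) = All.map⁺ (All.tabulate λ {L} L∈C →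
    subst (_∈ predC Fs) (sym (litOcc-substL σ L)) (predCl-⊆-predC C∈Fs (litOcc-∈-predCl L∈C)))

  PredsShared : Formula → Set
  PredsShared φ = ∀ x → x ∈ pred φ → x ∈ pred F × x ∈ pred G

  predsShared-closed : ClosedUnderConnectives PredsShared
  predsShared-closed = record
    { P-tt = λ _ ()
    ; P-ff = λ _ ()
    ; P-∧ = λ {φ} p q x m → [ p x , q x ]′ (∈-++⁻ (predP true φ) m)
    ; P-∨ = λ {φ} p q x m → [ p x , q x ]′ (∈-++⁻ (predP true φ) m)
    }

  OccursOnSide : Literal × Side → Set
  OccursOnSide (L , s) = litOcc L ∈ predC (clausesOf s)

  blue-compl-pred : ∀ L → litOcc L ∈ predC NGc → litOcc (compl L) ∈ pred G
  blue-compl-pred (lit b p ts) m = predP-not false G (NGc-pred _ m)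

  leafIpol-predsShared : ∀ s t L → OccursOnSide (L , s) → OccursOnSide (compl L , t) →
                     PredsShared (leafIpol s (just t) L)
  leafIpol-predsShared red red L _ _ x ()
  leafIpol-predsShared red blue L l c x m rewrite pred-litF L x m =
    Fc-pred _ l , subst (λ L′ → litOcc L′ ∈ pred G) (compl-involutive L) (blue-compl-pred (compl L) c)
  leafIpol-predsShared blue red L l c x m rewrite pred-litF (compl L) x m = Fc-pred _ c , blue-compl-pred L l
  leafIpol-predsShared blue blue L _ _ x ()

  leaf-predsShared : ∀ ctx s L i → ValidT ctx s (leaf L i) → All OccursOnSide ((L , s) ∷ ctx) →
                      PredsShared (ipolT ctx s (leaf L i))
  leaf-predsShared ctx s L i (_ , (L′ , t) , nth≡ , L′≡) (occ ∷ occs) rewrite targetSide-nth ctx i nth≡ =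
    leafIpol-predsShared s t L occ (subst (λ L″ → OccursOnSide (L″ , t)) L′≡ (nth-All i occs nth≡))

  ipolRoot-predsShared : ∀ T → ClosedGroundTableau T → PredsShared (ipolRoot T)
  ipolRoot-predsShared = IpolInduction.ipolRoot-preserves Fc NGc k PredsShared predsShared-closed
    OccursOnSide (λ s D inst → instance-litOcc (clausesOf s) D inst) leaf-predsShared

mutual
  evalT-ground : ∀ M ρ ρ′ t → Ground t → evalT M ρ t ≡ evalT M ρ′ t
  evalT-ground M ρ ρ′ (app f ts) g = cong (Structure.fn M f) (evalTs-ground M ρ ρ′ ts g)

  evalTs-ground : ∀ M ρ ρ′ ts → Grounds ts → evalTs M ρ ts ≡ evalTs M ρ′ ts
  evalTs-ground M ρ ρ′ [] _ = refl
  evalTs-ground M ρ ρ′ (t ∷ ts) (g , gs) = cong₂ _∷_ (evalT-ground M ρ ρ′ t g) (evalTs-ground M ρ ρ′ ts gs)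

HeadIn : (Sym → Set) → Term → Set
HeadIn P (var _) = ⊥
HeadIn P (app f ts) = P (f , length ts)

-- Elements of a tagged structure carry the ground term they denote, so the
-- value of an overridable ground term can be reassigned without disturbing any
-- other term, even one that has the same value in M.
module Tagged (M : Structure) (Overridable : Sym → Set) where
  open Structure M

  Overrides : Set
  Overrides = List (Term × D)

  OverridesOk : Overrides → Set
  OverridesOk = All (HeadIn Overridable ∘ proj₁)

  override : Overrides → Term → D → D
  override [] w d = d
  override ((u , e) ∷ θ) w d with u ≟ᵗ w
  ... | yes _ = e
  ... | no _ = override θ w d

  tagged : Overrides → Structure
  tagged θ = record
    { D = D × Term
    ; fn = λ f xs → override θ (app f (map proj₂ xs)) (fn f (map proj₁ xs)) , app f (map proj₂ xs)
    ; pr = λ p xs → pr p (map proj₁ xs)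
    }

  mutual
    tag-evalT : ∀ θ ρ t → proj₂ (evalT (tagged θ) ρ t) ≡ substT (proj₂ ∘ ρ) t
    tag-evalT θ ρ (var x) = refl
    tag-evalT θ ρ (app f ts) = cong (app f) (tag-evalTs θ ρ ts)

    tag-evalTs : ∀ θ ρ ts → map proj₂ (evalTs (tagged θ) ρ ts) ≡ substTs (proj₂ ∘ ρ) ts
    tag-evalTs θ ρ [] = refl
    tag-evalTs θ ρ (t ∷ ts) = cong₂ _∷_ (tag-evalT θ ρ t) (tag-evalTs θ ρ ts)

  tag-evalTs-ground : ∀ θ ρ ts → Grounds ts → map proj₂ (evalTs (tagged θ) ρ ts) ≡ ts
  tag-evalTs-ground θ ρ ts g = trans (tag-evalTs θ ρ ts) (substTs-ground _ ts g)

  evalT-override-hit : ∀ θ ρ f ss e → Grounds ss → evalT (tagged ((app f ss , e) ∷ θ)) ρ (app f ss) ≡ (e , app f ss)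
  evalT-override-hit θ ρ f ss e g rewrite tag-evalTs-ground ((app f ss , e) ∷ θ) ρ ss g with app f ss ≟ᵗ app f ss
  ... | yes _ = refl
  ... | no ≢ = ⊥-elim (≢ refl)

  mutual
    evalT-override-miss : ∀ θ ρ t e u → Ground u → ¬ SubT t u →
                          evalT (tagged ((t , e) ∷ θ)) ρ u ≡ evalT (tagged θ) ρ u
    evalT-override-miss θ ρ t e (app f us) g t∉u
      rewrite evalTs-override-miss θ ρ t e us g (t∉u ∘ inj₂) | tag-evalTs-ground θ ρ us g with t ≟ᵗ app f us
    ... | yes t≡u = ⊥-elim (t∉u (inj₁ t≡u))
    ... | no _ = refl

    evalTs-override-miss : ∀ θ ρ t e us → Grounds us → ¬ SubTs t us →
                           evalTs (tagged ((t , e) ∷ θ)) ρ us ≡ evalTs (tagged θ) ρ us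
    evalTs-override-miss θ ρ t e [] _ _ = refl
    evalTs-override-miss θ ρ t e (u ∷ us) (g , gs) t∉us =
      cong₂ _∷_ (evalT-override-miss θ ρ t e u g (t∉us ∘ inj₁)) (evalTs-override-miss θ ρ t e us gs (t∉us ∘ inj₂))

  override-unaffected : ∀ θ f ts d → OverridesOk θ → ¬ Overridable (f , length ts) → override θ (app f ts) d ≡ d
  override-unaffected [] f ts d _ _ = refl
  override-unaffected ((u , e) ∷ θ) f ts d (ok ∷ oks) n with u ≟ᵗ app f ts
  ... | yes refl = ⊥-elim (n ok)
  ... | no _ = override-unaffected θ f ts d oks n

  private
    map-proj₁ : ∀ {as : List (D × Term)} {bs} → Pointwise (λ x d → proj₁ x ≡ d) as bs → map proj₁ as ≡ bs
    map-proj₁ [] = refl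
    map-proj₁ (r ∷ rs) = cong₂ _∷_ r (map-proj₁ rs)

    module Forget = Transfer (tagged []) M (λ x d → proj₁ x ≡ d) (λ x → proj₁ x , refl) (λ d → (d , var 0) , refl)
      (λ p rel → subst (λ bs → pr p _ ⇔ pr p bs) (map-proj₁ rel) (⇔-id _))

  tagged-[]-sat : ∀ ρ σ φ → (∀ x → proj₁ (ρ x) ≡ σ x) → sat (tagged []) ρ φ ⇔ sat M σ φ
  tagged-[]-sat ρ σ φ agree = Forget.sat-transfer φ (λ x _ → agree x) (λ f _ rel → cong (fn f) (map-proj₁ rel))

  tagged-[]-sat-proj₁ : ∀ ρ ρ′ φ → (∀ x → proj₁ (ρ x) ≡ proj₁ (ρ′ x)) →
                        sat (tagged []) ρ φ → sat (tagged []) ρ′ φ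
  tagged-[]-sat-proj₁ ρ ρ′ φ agree s =
    from (tagged-[]-sat ρ′ (proj₁ ∘ ρ) φ (sym ∘ agree)) (to (tagged-[]-sat ρ (proj₁ ∘ ρ) φ (λ _ → refl)) s)

  tagged-override-sat : ∀ θ ρ φ → OverridesOk θ → (∀ h → h ∈ funF φ → ¬ Overridable h) →
                        sat (tagged θ) ρ φ ⇔ sat (tagged []) ρ φ
  tagged-override-sat θ ρ φ ok φ-untouched = sat-withFns (tagged []) (Structure.fn (tagged θ)) ρ ρ φ (λ _ _ → refl)
    λ f xs m → cong (_, app f (map proj₂ xs))
      (override-unaffected θ f (map proj₂ xs) _ ok
        (subst (λ n → ¬ Overridable (f , n)) (sym (length-map proj₂ xs)) (φ-untouched _ m)))

update-≡ : ∀ M ρ x d → update M ρ x d x ≡ d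
update-≡ M ρ x d with x ≟ x
... | yes _ = refl
... | no x≢x = ⊥-elim (x≢x refl)

update-≢ : ∀ M ρ x d y → x ≢ y → update M ρ x d y ≡ ρ y
update-≢ M ρ x d y x≢y with x ≟ y
... | yes x≡y = ⊥-elim (x≢y x≡y)
... | no _ = refl

CanPrecede : Binding → Binding → Set
CanPrecede b b′ = ¬ SubT (bterm b′) (bterm b) × bvar b ≢ bvar b′

bindings-sorted : ∀ qs → Unique (map bterm qs) → Unique (map bvar qs) →
  (∀ (i j : Fin (length qs)) → StrictSub (bterm (lookup qs i)) (bterm (lookup qs j)) → i <ᶠ j) →
  AllPairs CanPrecede qs
bindings-sorted [] _ _ _ = []
bindings-sorted (b ∷ bs) (b∉terms ∷ terms-unique) (b∉vars ∷ vars-unique) order =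
  All.tabulate (λ b′∈bs → not-inside b′∈bs , All.lookup (All.map⁻ b∉vars) b′∈bs)
  ∷ bindings-sorted bs terms-unique vars-unique (λ i j sub → ≤-pred (order (fsuc i) (fsuc j) sub))
  where
  not-inside : ∀ {b′} → b′ ∈ bs → ¬ SubT (bterm b′) (bterm b)
  not-inside b′∈bs (inj₁ b′≡b) = All.lookup (All.map⁻ b∉terms) b′∈bs (sym b′≡b)
  not-inside b′∈bs (inj₂ sub) with order (fsuc (Any.index b′∈bs)) fzero
                                     (subst (λ c → StrictSub (bterm c) (bterm b)) (Any.lookup-index b′∈bs) sub)
  ... | ()

opponentQuant : Side → Quant
opponentQuant red = ∀q
opponentQuant blue = ∃q

-- A binding quantified in our favour takes the value of its term; for the
-- others the opponent's value is forced onto the term by an override.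
module Game (M : Structure) (Overridable : Sym → Set) (qs : List Binding) (Hq : Formula) where
  open Structure M
  open Tagged M Overridable

  Admissible : Side → Binding → Set
  Admissible S b = Ground (bterm b) × (bquant b ≡ opponentQuant S → HeadIn Overridable (bterm b))

  record Settled (θ : Overrides) (ρ : ℕ → D × Term) (bs : List Binding) (p : Binding) : Set where
    field
      ground : Ground (bterm p)
      precedes : All (CanPrecede p) bs
      denotes : Denotes (tagged θ) ρ p

  record Position (S : Side) (done bs : List Binding) (θ : Overrides) (ρ : ℕ → D × Term) : Set where
    field
      overrides-ok : OverridesOk θ
      admissible : All (Admissible S) bs
      sorted : AllPairs CanPrecede bs
      settled : All (Settled θ ρ bs) done
      split : done ++ bs ≡ qs

  advance : ∀ {S done b bs θ ρ} θ′ d → Position S done (b ∷ bs) θ ρ → OverridesOk θ′ →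
    (∀ {p} → Settled θ ρ (b ∷ bs) p → evalT (tagged θ′) ρ (bterm p) ≡ evalT (tagged θ) ρ (bterm p)) →
    d ≡ evalT (tagged θ′) ρ (bterm b) →
    Position S (done ∷ʳ b) bs θ′ (update (tagged []) ρ (bvar b) d)
  advance {S} {done} {b} {bs} {θ} {ρ} θ′ d pos ok′ unchanged d≡ = record
    { overrides-ok = ok′
    ; admissible = All.tail admissible
    ; sorted = AllPairs.tail sorted
    ; settled = All.∷ʳ⁺ (All.map keep settled) new
    ; split = trans (∷ʳ-++ done b bs) split
    }
    where
    open Position pos
    ρ′ = update (tagged []) ρ (bvar b) d
    b-ground = proj₁ (All.head admissible)

    keep : ∀ {p} → Settled θ ρ (b ∷ bs) p → Settled θ′ ρ′ bs p
    keep {p} s = record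
      { ground = ground
      ; precedes = All.tail precedes
      ; denotes = begin
          ρ′ (bvar p)                     ≡⟨ update-≢ (tagged []) ρ (bvar b) d (bvar p) b≢p ⟩
          ρ (bvar p)                      ≡⟨ denotes ⟩
          evalT (tagged θ) ρ (bterm p)    ≡⟨ unchanged s ⟨
          evalT (tagged θ′) ρ (bterm p)   ≡⟨ evalT-ground (tagged θ′) ρ ρ′ (bterm p) ground ⟩
          evalT (tagged θ′) ρ′ (bterm p)  ∎
      }
      where
      open Settled s
      open ≡-Reasoning
      b≢p = proj₂ (All.head precedes) ∘ sym

    new : Settled θ′ ρ′ bs b
    new = record
      { ground = b-ground
      ; precedes = AllPairs.head sorted
      ; denotes = trans (update-≡ (tagged []) ρ (bvar b) d)
                        (trans d≡ (evalT-ground (tagged θ′) ρ ρ′ (bterm b) b-ground))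
      }

  update-proj₁ : ∀ (ρ : ℕ → D × Term) z d t y →
                 proj₁ (update (tagged []) ρ z (proj₁ d , t) y) ≡ proj₁ (update (tagged []) ρ z d y)
  update-proj₁ ρ z d t y with z ≟ y
  ... | yes _ = refl
  ... | no _ = refl

  quantify-step : ∀ S t z q bs ρ d →
    Signed S (sat (tagged []) (update (tagged []) ρ z d) (quantify bs Hq)) →
    (q ≡ opponentQuant S → ∀ e → Signed S (sat (tagged []) (update (tagged []) ρ z (e , t)) (quantify bs Hq))) →
    Signed S (sat (tagged []) ρ (quantify (bind t z q ∷ bs) Hq))
  quantify-step red t z ∃q bs ρ d ours _ = d , ours
  quantify-step blue t z ∀q bs ρ d ours _ = λ h → ours (h d)
  quantify-step red t z ∀q bs ρ d _ theirs =
    λ e → tagged-[]-sat-proj₁ _ _ (quantify bs Hq) (update-proj₁ ρ z e t) (theirs refl (proj₁ e))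
  quantify-step blue t z ∃q bs ρ d _ theirs =
    λ (e , s) → theirs refl (proj₁ e) (tagged-[]-sat-proj₁ _ _ (quantify bs Hq) (sym ∘ update-proj₁ ρ z e t) s)

  module _ (S : Side)
    (win : ∀ θ ρ → OverridesOk θ → All (Denotes (tagged θ) ρ) qs → Signed S (sat (tagged []) ρ Hq))
    where

    play : ∀ done bs θ ρ → Position S done bs θ ρ → Signed S (sat (tagged []) ρ (quantify bs Hq))
    play done [] θ ρ pos = win θ ρ overrides-ok
      (subst (All (Denotes (tagged θ) ρ)) (trans (sym (++-identityʳ done)) split) (All.map Settled.denotes settled))
      where open Position pos
    play done (bind (var x) z q ∷ bs) θ ρ pos with All.head (Position.admissible pos)
    ... | () , _
    play done (b@(bind (app f ss) z q) ∷ bs) θ ρ pos =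
      quantify-step S (bterm b) z q bs ρ _ ours (λ q≡ → theirs (proj₂ (All.head admissible) q≡))
      where
      open Position pos

      ours : Signed S (sat (tagged []) (update (tagged []) ρ z (evalT (tagged θ) ρ (bterm b))) (quantify bs Hq))
      ours = play (done ∷ʳ b) bs θ _ (advance θ _ pos overrides-ok (λ _ → refl) refl)

      theirs : HeadIn Overridable (bterm b) → ∀ e →
               Signed S (sat (tagged []) (update (tagged []) ρ z (e , bterm b)) (quantify bs Hq))
      theirs overridable e = play (done ∷ʳ b) bs θ′ _
        (advance θ′ _ pos (overridable ∷ overrides-ok)
          (λ s → evalT-override-miss θ ρ (bterm b) e _ (Settled.ground s) (proj₁ (All.head (Settled.precedes s))))
          (sym (evalT-override-hit θ ρ f ss e (proj₁ (All.head admissible)))))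
        where θ′ = (bterm b , e) ∷ θ

Signed-⇔ : ∀ S {P Q} → P ⇔ Q → Signed S P → Signed S Q
Signed-⇔ red P⇔Q = to P⇔Q
Signed-⇔ blue P⇔Q ¬P q = ¬P (from P⇔Q q)

FreeIn-quantify : ∀ x bs φ → FreeIn x (quantify bs φ) → FreeIn x φ × x ∉ map bvar bs
FreeIn-quantify x [] φ free = free , λ ()
FreeIn-quantify x (bind t z ∀q ∷ bs) φ (x≢z , free) with FreeIn-quantify x bs φ free
... | free′ , x∉bs = free′ , λ { (here x≡z) → x≢z x≡z ; (there x∈bs) → x∉bs x∈bs }
FreeIn-quantify x (bind t z ∃q ∷ bs) φ (x≢z , free) with FreeIn-quantify x bs φ free
... | free′ , x∉bs = free′ , λ { (here x≡z) → x≢z x≡z ; (there x∈bs) → x∉bs x∈bs }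

predP-quantify : ∀ b bs φ → predP b (quantify bs φ) ≡ predP b φ
predP-quantify b [] φ = refl
predP-quantify b (bind t z ∀q ∷ bs) φ = predP-quantify b bs φ
predP-quantify b (bind t z ∃q ∷ bs) φ = predP-quantify b bs φ

funF-quantify : ∀ bs φ → funF (quantify bs φ) ≡ funF φ
funF-quantify [] φ = refl
funF-quantify (bind t z ∀q ∷ bs) φ = funF-quantify bs φ
funF-quantify (bind t z ∃q ∷ bs) φ = funF-quantify bs φ

funF-litF-⊆-funCl : ∀ {L C h} → L ∈ C → h ∈ funF (litF L) → h ∈ funCl C
funF-litF-⊆-funCl {lit true p ts} {_ ∷ C} (here refl) m = ∈-++⁺ˡ m
funF-litF-⊆-funCl {lit false p ts} {_ ∷ C} (here refl) m = ∈-++⁺ˡ m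
funF-litF-⊆-funCl {C = lit b p ts ∷ C} (there L∈C) m = ∈-++⁺ʳ (funTs ts) (funF-litF-⊆-funCl L∈C m)

funCl-⊆-funC : ∀ {C Fs h} → C ∈ Fs → h ∈ funCl C → h ∈ funC Fs
funCl-⊆-funC {Fs = C ∷ Fs} (here refl) m = ∈-++⁺ˡ m
funCl-⊆-funC {Fs = C′ ∷ Fs} (there C∈) m = ∈-++⁺ʳ (funCl C′) (funCl-⊆-funC C∈ m)

satC-pullback : ∀ M₁ M₂ Fs →
  (∀ ρ₁ → ∃ λ ρ₂ → ∀ {C L} → C ∈ Fs → L ∈ C → satL M₂ ρ₂ L → satL M₁ ρ₁ L) →
  satC M₂ Fs → satC M₁ Fs
satC-pullback M₁ M₂ Fs pull sat₂ ρ₁ with pull ρ₁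
... | ρ₂ , imp = All.tabulate λ C∈Fs →
  let (L , L∈C , s) = find (All.lookup (sat₂ ρ₂) C∈Fs) in lose L∈C (imp C∈Fs L∈C s)

module Correctness (em : ExcludedMiddle 0ℓ) (F G : Formula) (F-closed : Sentence F) (G-closed : Sentence G)
  (H : Formula) (run : CTIRun F G H) where
  open CTIRun run
  open Tableaux Fc NGc k using (clausesOf; allowedSyms)
  open Lifting Fc NGc k using (IsFsym; IsGsym)
  open HbSyntax Fc NGc k
  open ReplaceLemmas qs

  Hb : Formula
  Hb = ipolRoot T

  Hb-allowedQF : AllowedQF Hb
  Hb-allowedQF = ipolRoot-allowedQF T T-closed

  H′ : Formula
  H′ = quantify qs Hq

  Hq-fun : ∀ h → h ∈ funF Hq → UncoloredAllowed h
  Hq-fun = ReplF-funF Hb Hq Hb-allowedQF Hq-repl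

  k∉Fc : (k , 0) ∉ funC Fc
  k∉Fc m = k-fresh (∈-++⁺ʳ (funF F) (∈-++⁺ʳ (funF G) (∈-++⁺ʳ fs (∈-++⁺ʳ gs (∈-++⁺ˡ m)))))

  uncolored-shared : ∀ h → UncoloredAllowed h → h ∈ funC Fc × h ∈ funC NGc
  uncolored-shared h (allowed , uncolored) with ∈-++⁻ (funC Fc) allowed
  ... | inj₁ inFc with h ∈? funC NGc
  ...   | yes inNGc = inFc , inNGc
  ...   | no ∉NGc = ⊥-elim (uncolored (inj₁ (inFc , ∉NGc)))
  uncolored-shared h (allowed , uncolored) | inj₂ rest with ∈-++⁻ (funC NGc) rest
  ... | inj₂ (here refl) = ⊥-elim (uncolored (inj₂ (inj₂ refl)))
  ... | inj₁ inNGc with h ∈? funC Fc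
  ...   | yes inFc = inFc , inNGc
  ...   | no ∉Fc = ⊥-elim (uncolored (inj₂ (inj₁ (inNGc , ∉Fc))))

  clause-syms-shared : ∀ h → h ∈ funC Fc → h ∈ funC NGc → h ∈ funF F × h ∈ funF G
  clause-syms-shared h inFc inNGc with Fc-fun h inFc | NGc-fun h inNGc
  ... | inj₁ inF | inj₁ inG = inF , inG
  ... | inj₁ inF | inj₂ inGs = ⊥-elim (proj₁ (gs-fresh h inGs) inF)
  ... | inj₂ inFs | inj₁ inG = ⊥-elim (proj₂ (fs-fresh h inFs) inG)
  ... | inj₂ inFs | inj₂ inGs = ⊥-elim (fs-gs-disjoint h inFs inGs)

  H′-fun : ∀ h → h ∈ funF H′ → h ∈ funF F × h ∈ funF G
  H′-fun h m = let (inFc , inNGc) = uncolored-shared h (Hq-fun h (subst (h ∈_) (funF-quantify qs Hq) m))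
               in clause-syms-shared h inFc inNGc

  H′-pred : ∀ x → x ∈ pred H′ → x ∈ pred F × x ∈ pred G
  H′-pred x m = PredBookkeeping.ipolRoot-predsShared Fc NGc k F G Fc-pred NGc-pred T T-closed x
    (subst (x ∈_) (trans (predP-quantify true qs Hq) (predP-ReplF true Hb Hq Hq-repl)) m)

  H′-sentence : Sentence H′
  H′-sentence x free = let (free′ , x∉qs) = FreeIn-quantify x qs Hq free
                       in x∉qs (ReplF-free Hb Hq Hb-allowedQF Hq-repl x free′)

  opponentSyms : Side → Sym → Set
  opponentSyms red = IsGsym
  opponentSyms blue = IsFsym

  clauses-untouched : ∀ S h → h ∈ funC (clausesOf S) → ¬ opponentSyms S h
  clauses-untouched red h m (inj₁ (_ , ∉Fc)) = ∉Fc m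
  clauses-untouched red h m (inj₂ refl) = k∉Fc m
  clauses-untouched blue h m (_ , ∉NGc) = ∉NGc m

  Hq-untouched : ∀ S h → h ∈ funF Hq → ¬ opponentSyms S h
  Hq-untouched red h m g = proj₂ (Hq-fun h m) (inj₂ g)
  Hq-untouched blue h m f = proj₂ (Hq-fun h m) (inj₁ f)

  opponent-quantified : ∀ S b → b ∈ qs → bquant b ≡ opponentQuant S → HeadIn (opponentSyms S) (bterm b)
  opponent-quantified red (bind (var _) _ _) b∈qs = proj₁ (qs-quant _ b∈qs)
  opponent-quantified red (bind (app _ _) _ _) b∈qs = proj₁ (qs-quant _ b∈qs)
  opponent-quantified blue (bind (var _) _ _) b∈qs = proj₂ (qs-quant _ b∈qs)
  opponent-quantified blue (bind (app _ _) _ _) b∈qs = proj₂ (qs-quant _ b∈qs)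

  bound-ground : ∀ b → b ∈ qs → Ground (bterm b)
  bound-ground b b∈qs =
    topOccF-ground (bterm b) Hb Hb-allowedQF (proj₂ (proj₁ (qs-assigned (bterm b)) (∈-map⁺ bterm b∈qs)))

  H′-signed : ∀ S M → satC M (clausesOf S) → ∀ ρ → Signed S (sat M ρ H′)
  H′-signed S M sat-S ρ =
    Signed-⇔ S (tagged-[]-sat ρ₀ ρ H′ (λ _ → refl)) (play S win [] qs [] ρ₀ start)
    where
    open Tagged M (opponentSyms S)
    open Game M (opponentSyms S) qs Hq

    ρ₀ : ℕ → Structure.D M × Term
    ρ₀ x = ρ x , var 0

    start : Position S [] qs [] ρ₀
    start = record
      { overrides-ok = []
      ; admissible = All.tabulate λ b∈qs → bound-ground _ b∈qs , opponent-quantified S _ b∈qs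
      ; sorted = bindings-sorted qs qs-terms-unique qs-vars-unique qs-order
      ; settled = []
      ; split = refl
      }

    tagged-model : ∀ θ → OverridesOk θ → satC (tagged θ) (clausesOf S)
    tagged-model θ ok = satC-pullback (tagged θ) M (clausesOf S)
      (λ ρ₁ → proj₁ ∘ ρ₁ , λ {_} {L} C∈ L∈C s →
        from (tagged-override-sat θ ρ₁ (litF L) ok
               (λ h m → clauses-untouched S h (funCl-⊆-funC C∈ (funF-litF-⊆-funCl L∈C m))))
             (from (tagged-[]-sat ρ₁ (proj₁ ∘ ρ₁) (litF L) (λ _ → refl)) s))
      sat-S

    win : ∀ θ ρ → OverridesOk θ → All (Denotes (tagged θ) ρ) qs → Signed S (sat (tagged []) ρ Hq)
    win θ ρ ok denotes =
      Signed-⇔ S (tagged-override-sat θ ρ Hq ok (Hq-untouched S))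
        (Signed-⇔ S (⇔-sym (ReplF-sat (tagged θ) ρ denotes Hb Hq Hb-allowedQF Hq-repl))
          (Soundness.ipolRoot-sound Fc NGc k (tagged θ) ρ S T T-closed (tagged-model θ ok)))

  F⊨H′ : F ⊨ H′
  F⊨H′ M ρ satF with proj₁ (Fc-equiv M) (λ ρ′ → sentence-env-irrelevant M F F-closed ρ ρ′ satF)
  ... | fn′ , agree , sat-Fc =
    to (sat-withFns M fn′ ρ ρ H′ (λ _ _ → refl) unskolemise) (H′-signed red (withFns M fn′) sat-Fc ρ)
    where
    unskolemise : ∀ f as → (f , length as) ∈ funF H′ → fn′ f as ≡ Structure.fn M f as
    unskolemise f as m = agree f as λ inFs → proj₁ (fs-fresh _ inFs) (proj₁ (H′-fun _ m))

  H′⊨G : H′ ⊨ G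
  H′⊨G M ρ satH′ with em {sat M ρ G}
  ... | yes satG = satG
  ... | no ¬satG with proj₁ (NGc-equiv M) (λ ρ′ satG′ → ¬satG (sentence-env-irrelevant M G G-closed ρ′ ρ satG′))
  ... | fn′ , agree , sat-NGc =
    ⊥-elim (H′-signed blue (withFns M fn′) sat-NGc ρ (from (sat-withFns M fn′ ρ ρ H′ (λ _ _ → refl) unskolemise) satH′))
    where
    unskolemise : ∀ f as → (f , length as) ∈ funF H′ → fn′ f as ≡ Structure.fn M f as
    unskolemise f as m = agree f as λ inGs → proj₂ (gs-fresh _ inGs) (proj₂ (H′-fun _ m))

  interpolant : Interpolant F G H
  interpolant = subst (Interpolant F G) (sym output) (H′-sentence , F⊨H′ , H′⊨G , H′-pred , H′-fun)

theorem1 : ExcludedMiddle 0ℓ →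
    (F G : Formula) → Sentence F → Sentence G → F ⊨ G →
    (H : Formula) → CTIRun F G H → Interpolant F G H
theorem1 em F G F-closed G-closed _ H run = Correctness.interpolant em F G F-closed G-closed H run
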